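{- Let $H$ be a pseudoexpander, $M$ a pseudomatching of $H$, and $0\le\eta\le1$. Then for every set $S$ of literals with $Vars(S)=V(H)\setminus\bigcup M$ which is $\eta$-comfortable with respect to $M$, and for every $\varphi\in{\bf CNF}(M)$, $Pr({\bf ES}(\varphi)\mid{\bf EC}(S))\le(2/3)^{\eta|M|}$.
   Context: Binary-tree-based graph: $H$ is an edge-disjoint union of extended rooted trees (no leaf has a sibling) $T_1,\dots,T_m$ with roots $t_1,\dots,t_m$, every vertex that is a leaf of some $T_i$ is a leaf of exactly two trees, and any two trees share at most one vertex, which is a leaf of both. Root variables are the roots, leaf variables the leaves of the trees, internal variables the other vertices (each lies in exactly one tree); two internal vertices are siblings if they lie in the same $T_i$ and are siblings there. If $T_i,T_j$ share a leaf $\ell_{i,j}$, $\{t_i,t_j\}$ is a pseudoedge; $P^{1/2}_{i\to j}$ is the path in $T_i$ from $t_i$ to $\ell_{i,j}$ and $P_{i,j}$ the path from $t_i$ to $t_j$ in $T_i\cup T_j$. A pseudomatching $M$ is a set of pseudoedges with pairwise disjoint ends; $\bigcup M$ is the set of ends. $H$ is a pseudoexpander if, with $m$ roots, every tree has height (max number of vertices on a root–leaf path) $\le(\log_2 m)/4.9+3$ and any two disjoint root sets of size $\ge m^{0.999}$ admit a pseudomatching of size $\ge m^{0.999}/3$ with each pseudoedge having one end in each set. $\phi_H$: monotone CNF over $V(H)$ with one clause $C_{i,j}=\bigvee_{v\in V(P_{i,j})}v$ per pseudoedge. ${\bf CNF}(M)$: CNFs with, for each $\{t_i,t_j\}\in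 M$, exactly one clause, equal to $\bigvee_{v\in V(P^{1/2}_{i\to j})}v$ or $\bigvee_{v\in V(P^{1/2}_{j\to i})}v$. Sets of literals never contain a variable with its negation. $S$ falsifies a clause if all its variables occur negatively in $S$. $S$ respects a pseudoedge $\{t_i,t_j\}$ if all non-root variables of $C_{i,j}$ occur negatively in $S$ and all siblings of the internal variables of $C_{i,j}$ occur positively in $S$. $S$ is $\eta$-comfortable w.r.t. $M$ if $S$ falsifies no clause of $\phi_H$ and respects at least $\eta|M|$ pseudoedges of $M$. $Fix(S)$: set of positive literals $\ell_{i,j}\in S$ such that all other variables of $C_{i,j}$ occur negatively in $S$. Probability space on ${\bf SAT}(H)$ (sets of literals over all of $V(H)$ satisfying $\phi_H$) with $Pr(\{S\})=2^{ -|S\setminus Fix(S)|}$. ${\bf EC}(S)=\{S'\in{\bf SAT}(H):S\subseteq S'\}$, ${\bf ES}(\varphi)=\{S'\in{\bf SAT}(H):S'\text{ satisfies }\varphi\}$.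
   Formalization: The parameter η ranges over the rationals in [0,1]. -}

module Defs where

open import Data.Bool using (Bool; true; false; _∧_; _∨_; not; if_then_else_)
open import Data.Nat using (ℕ; zero; suc; _+_; _*_; _∸_; _^_; _≤_)
open import Data.Fin using (Fin; toℕ)
import Data.Fin as Fin
open import Data.Fin.Properties using (_≟_)
open import Data.Fin.Subset using (Subset; _∈_; ∣_∣)
open import Data.List using (List; []; _∷_; length; lookup; filter; map; _++_)
open import Data.Maybe using (Maybe; just; nothing)
open import Data.Product using (Σ; ∃; _×_; _,_)
open import Data.Sum using (_⊎_)
open import Data.Empty using (⊥)
import Data.Bool.Properties as BP
import Data.List as L
open import Data.Integer using (+_)
open import Data.Rational using (ℚ; ½; 0ℚ; 1ℚ) renaming (_+_ to _+ℚ_; _*_ to _*ℚ_; _≤_ to _≤ℚ_)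
import Data.Rational as Q
open import Relation.Nullary using (¬_; does)
open import Relation.Binary.PropositionalEquality using (_≡_; _≢_)

anyFin : ∀ {n} → (Fin n → Bool) → Bool
anyFin {zero}  f = false
anyFin {suc n} f = f Fin.zero ∨ anyFin (λ k → f (Fin.suc k))

allFin : ∀ {n} → (Fin n → Bool) → Bool
allFin f = not (anyFin (λ k → not (f k)))

_==_ : ∀ {n} → Fin n → Fin n → Bool
x == y = does (x ≟ y)

_⇒ᵇ_ : Bool → Bool → Bool
a ⇒ᵇ b = not a ∨ b

iter : ∀ {A : Set} → (A → A) → ℕ → A → A
iter f zero    x = x
iter f (suc k) x = f (iter f k x)

-- Raw data of a binary-tree-based graph on vertex set V(H) = Fin n
-- with m trees T_0 … T_{m-1}.
--   inT i v   : v is a vertex of T_i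
--   root i    : the root t_i of T_i
--   par i v   : the parent of v in T_i (convention: par i (root i) = root i;
--               values outside T_i are irrelevant)

record TreeFamily (n m : ℕ) : Set where
  field
    inT  : Fin m → Fin n → Bool
    root : Fin m → Fin n
    par  : Fin m → Fin n → Fin n

module _ {n m : ℕ} (G : TreeFamily n m) where
  open TreeFamily G

  isChild : Fin m → Fin n → Fin n → Bool
  isChild i u v = inT i u ∧ not (u == root i) ∧ (par i u == v)

  isLeaf : Fin m → Fin n → Bool
  isLeaf i v = inT i v ∧ not (v == root i) ∧ not (anyFin (λ u → isChild i u v))

  isRootVar : Fin n → Bool
  isRootVar v = anyFin (λ k → root k == v)

  isLeafVar : Fin n → Bool
  isLeafVar v = anyFin (λ k → isLeaf k v)

  isInternal : Fin n → Bool
  isInternal v = not (isRootVar v) ∧ not (isLeafVar v)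

  isSibling : Fin n → Fin n → Bool
  isSibling v u = isInternal v ∧ isInternal u ∧ not (u == v) ∧
    anyFin (λ k → inT k v ∧ inT k u ∧ (par k u == par k v))

  -- u lies on the path in T_i from the root t_i to v
  -- (u is v or an ancestor of v; depths are < n, so n iterations suffice)
  onPathToRoot : Fin m → Fin n → Fin n → Bool
  onPathToRoot i v u = inT i u ∧ anyFin {n} (λ k → iter (par i) (toℕ k) v == u)

  -- Pseudoedges are stored as triples (i , j , ℓ) with ℓ = ℓ_{i,j}
  PEdge : Set
  PEdge = Fin m × Fin m × Fin n

  isPE : Fin m → Fin m → Fin n → Bool
  isPE i j ℓ = not (i == j) ∧ isLeaf i ℓ ∧ isLeaf j ℓ

  fullClause : PEdge → Fin n → Bool
  fullClause (i , j , ℓ) v = onPathToRoot i ℓ v ∨ onPathToRoot j ℓ v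

  halfClause : PEdge → Fin n → Bool
  halfClause (i , j , ℓ) v = onPathToRoot i ℓ v

  ends : PEdge → Fin m → Bool
  ends (i , j , ℓ) k = (k == i) ∨ (k == j)

  IsPseudomatching : List PEdge → Set
  IsPseudomatching M =
    (∀ (x : Fin (length M)) → let (i , j , ℓ) = lookup M x in isPE i j ℓ ≡ true) ×
    (∀ (x y : Fin (length M)) → x ≢ y →
       ∀ k → ends (lookup M x) k ≡ true → ends (lookup M y) k ≡ false)

  -- ⋃ M as a set of variables (the roots of the ends)
  inUnionM : List PEdge → Fin n → Bool
  inUnionM M v = anyFin (λ x → anyFin (λ k → ends (lookup M x) k ∧ (root k == v)))

  -- A set of literals is a partial map Fin n → Maybe Bool
  -- (just true = positive literal, just false = negative literal);
  -- a set of literals over all of V(H) is a total map Fin n → Bool.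

  Literals : Set
  Literals = Fin n → Maybe Bool

  isNeg : Maybe Bool → Bool
  isNeg (just false) = true
  isNeg _            = false

  isPos : Maybe Bool → Bool
  isPos (just true) = true
  isPos _           = false

  falsifies : Literals → (Fin n → Bool) → Bool
  falsifies S C = allFin (λ v → C v ⇒ᵇ isNeg (S v))

  respects : Literals → PEdge → Bool
  respects S e = allFin (λ v →
      ((fullClause e v ∧ not (isRootVar v)) ⇒ᵇ isNeg (S v)) ∧
      ((fullClause e v ∧ isInternal v) ⇒ᵇ allFin (λ u → isSibling v u ⇒ᵇ isPos (S u))))

  countRespected : Literals → List PEdge → ℕ
  countRespected S M = length (filter (λ e → respects S e BP.≟ true) M)

  falsifiesNoClause : Literals → Set
  falsifiesNoClause S = ∀ i j ℓ → isPE i j ℓ ≡ true → falsifies S (fullClause (i , j , ℓ)) ≡ false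

  -- η-comfortable with η = p / q : q · #respected ≥ p · |M|
  IsComfortable : ℕ → ℕ → Literals → List PEdge → Set
  IsComfortable p q S M = falsifiesNoClause S × p * length M ≤ q * countRespected S M

  satClause : (Fin n → Bool) → (Fin n → Bool) → Bool
  satClause A C = anyFin (λ v → C v ∧ A v)

  satH : (Fin n → Bool) → Bool
  satH A = allFin (λ i → allFin (λ j → allFin (λ ℓ →
             isPE i j ℓ ⇒ᵇ satClause A (fullClause (i , j , ℓ)))))

  -- φ ∈ CNF(M) is given by an orientation choice for each pseudoedge of M:
  -- true ↦ P^{1/2}_{i→j},  false ↦ P^{1/2}_{j→i}
  CNFof : List PEdge → Set
  CNFof M = Fin (length M) → Bool

  clauseOf : (M : List PEdge) → CNFof M → Fin (length M) → Fin n → Bool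
  clauseOf M φ x with lookup M x
  ... | (i , j , ℓ) = if φ x then halfClause (i , j , ℓ) else halfClause (j , i , ℓ)

  satCNF : (M : List PEdge) → CNFof M → (Fin n → Bool) → Bool
  satCNF M φ A = allFin (λ x → satClause A (clauseOf M φ x))

  extends : Literals → (Fin n → Bool) → Bool
  extends S A = allFin (λ v → ext (S v) (A v))
    where
      ext : Maybe Bool → Bool → Bool
      ext nothing  _ = true
      ext (just b) a = does (b BP.≟ a)

  inFix : (Fin n → Bool) → Fin n → Bool
  inFix A v = A v ∧ anyFin (λ i → anyFin (λ j → isPE i j v ∧
                allFin (λ u → (fullClause (i , j , v) u ∧ not (u == v)) ⇒ᵇ not (A u))))

  countFix : (Fin n → Bool) → ℕ
  countFix A = length (filter (λ v → inFix A v BP.≟ true) (L.allFin n))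

powℚ : ℚ → ℕ → ℚ
powℚ x zero    = 1ℚ
powℚ x (suc k) = x *ℚ powℚ x k

twoThirds : ℚ
twoThirds = + 2 Q./ 3

allAssignments : (n : ℕ) → List (Fin n → Bool)
allAssignments zero    = (λ ()) ∷ []
allAssignments (suc n) =
  map (λ f → λ { Fin.zero → false ; (Fin.suc k) → f k }) (allAssignments n) ++
  map (λ f → λ { Fin.zero → true  ; (Fin.suc k) → f k }) (allAssignments n)

sumℚ : List ℚ → ℚ
sumℚ []       = 0ℚ
sumℚ (x ∷ xs) = x +ℚ sumℚ xs

module _ {n m : ℕ} (G : TreeFamily n m) where

  -- Pr({A}) = 2^{-|A \ Fix(A)|}  (A is total on n variables)
  weight : (Fin n → Bool) → ℚ
  weight A = powℚ ½ (n ∸ countFix G A)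

  -- Pr(X) for X = { A ∈ SAT(H) : P A } (unnormalised sum of point weights)
  measure : ((Fin n → Bool) → Bool) → ℚ
  measure P = sumℚ (map (λ A → if satH G A ∧ P A then weight A else 0ℚ) (allAssignments n))

  prEC : Literals G → ℚ
  prEC S = measure (extends G S)

  prESEC : (M : List (PEdge G)) → CNFof G M → Literals G → ℚ
  prESEC M φ S = measure (λ A → satCNF G M φ A ∧ extends G S A)

record IsBTGraph {n m : ℕ} (G : TreeFamily n m) : Set where
  open TreeFamily G
  field
    rootIn   : ∀ i → inT i (root i) ≡ true
    parRoot  : ∀ i → par i (root i) ≡ root i
    parIn    : ∀ i v → inT i v ≡ true → inT i (par i v) ≡ true
    reach    : ∀ i v → inT i v ≡ true → ∃ λ k → iter (par i) k v ≡ root i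
    covered  : ∀ v → ∃ λ i → inT i v ≡ true
    leafNoSibling : ∀ i v u → isLeaf G i v ≡ true → inT i u ≡ true →
                    u ≢ root i → u ≢ v → par i u ≢ par i v
    leafTwice : ∀ i v → isLeaf G i v ≡ true →
                ∃ λ j → j ≢ i × isLeaf G j v ≡ true ×
                        (∀ k → isLeaf G k v ≡ true → k ≡ i ⊎ k ≡ j)
    shareLeaf : ∀ i j → i ≢ j → ∀ v → inT i v ≡ true → inT j v ≡ true →
                isLeaf G i v ≡ true × isLeaf G j v ≡ true
    shareOne  : ∀ i j → i ≢ j → ∀ v w → inT i v ≡ true → inT j v ≡ true →
                inT i w ≡ true → inT j w ≡ true → v ≡ w

record IsPseudoexpander {n m : ℕ} (G : TreeFamily n m) : Set where
  open TreeFamily G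
  field
    isBT : IsBTGraph G
    -- height(T_i) ≤ log₂ m / 4.9 + 3, i.e. every vertex v of T_i is at depth k
    -- (k+1 vertices on the path) with 4.9·((k+1) - 3) ≤ log₂ m,
    -- equivalently 2^(49·((k+1) ∸ 3)) ≤ m^10
    height : ∀ i v → inT i v ≡ true →
             ∃ λ k → iter (par i) k v ≡ root i × 2 ^ (49 * (suc k ∸ 3)) ≤ m ^ 10
    -- expansion: |A|,|B| ≥ m^0.999 (i.e. |A|^1000 ≥ m^999) gives a pseudomatching
    -- of size ≥ m^0.999/3 (i.e. (3|P|)^1000 ≥ m^999) across A and B
    expand : ∀ (A B : Subset m) → (∀ k → k ∈ A → k ∈ B → ⊥) →
             m ^ 999 ≤ ∣ A ∣ ^ 1000 → m ^ 999 ≤ ∣ B ∣ ^ 1000 →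
             Σ (List (PEdge G)) λ P → IsPseudomatching G P ×
               m ^ 999 ≤ (3 * length P) ^ 1000 ×
               (∀ (x : Fin (length P)) → let (i , j , ℓ) = lookup P x in
                  (i ∈ A × j ∈ B) ⊎ (i ∈ B × j ∈ A))

module Submission where

-- Fix a pseudoedge {tᵢ, tⱼ} of M respected by S.  In every extension A of S all non-root
-- variables of Cᵢⱼ are false, so A ∈ SAT(H) forces tᵢ or tⱼ true, and the clause of φ on this
-- pseudoedge lies in one of the two trees and can only be satisfied by its root.  Flipping one
-- end root while the other stays true changes neither membership in SAT(H) ∩ EC(S) nor Fix(A):
-- any other clause through that root runs into a sibling of the respected path, which S sets
-- true.  Hence the patterns (1,1), (1,0), (0,1) of (tᵢ, tⱼ) carry equal weight, and forcing the
-- chosen root keeps 2/3 of it.  Roots of distinct pseudoedges of M are distinct and unassigned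
-- by S, so this applies to each respected pseudoedge in turn:
-- Pr(ES(φ) ∩ EC(S)) ≤ (2/3)^#respected · Pr(EC(S)), which is the claim (with η = p/q) raised
-- to the q-th power.

open import Defs
open import Data.Nat as ℕ using (ℕ; zero; suc; _≤_; _<_; _*_; _+_; _∸_; z≤n; s≤s)
import Data.Nat.Properties as ℕ
open import Data.Fin as Fin using (Fin; toℕ)
open import Data.Fin.Properties using (_≟_; toℕ-injective; toℕ<n; toℕ-fromℕ<; injective⇒≤)
open import Data.Bool using (Bool; true; false; _∧_; _∨_; not; if_then_else_)
import Data.Bool.Properties as Bool
open import Data.Maybe using (Maybe; just; nothing)
open import Data.List using (List; []; _∷_; length; lookup; filter; map; _++_)
import Data.List as List
import Data.List.Properties as List
open import Data.List.Relation.Unary.All using (All; []; _∷_)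
import Data.List.Relation.Unary.All.Properties as All
open import Data.List.Relation.Unary.AllPairs using ([]; _∷_)
open import Data.List.Relation.Unary.Unique.Propositional using (Unique)
import Data.List.Relation.Unary.Unique.Propositional.Properties as Unique
open import Data.Product using (∃; ∃₂; _×_; _,_; proj₁; proj₂)
open import Data.Sum using (_⊎_; inj₁; inj₂)
open import Data.Empty using (⊥-elim)
open import Function using (_∘_; id)
open import Data.Vec.Functional using (updateAt) renaming (_∷_ to _∷ᵛ_)
open import Data.Vec.Functional.Properties using (updateAt-updates; updateAt-minimal)
open import Data.Rational using (ℚ; 0ℚ; 1ℚ; ½) renaming (_≤_ to _≤ℚ_; _*_ to _*ℚ_; _+_ to _+ℚ_)
import Data.Rational as ℚ
import Data.Rational.Properties as ℚ
open import Algebra.Bundles using (CommutativeMonoid; CommutativeRing)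
open import Algebra.Properties.CommutativeSemigroup
  (CommutativeMonoid.commutativeSemigroup ℚ.+-0-commutativeMonoid) using (interchange)
open import Algebra.Properties.CommutativeSemiring.Exp
  (CommutativeRing.commutativeSemiring ℚ.+-*-commutativeRing) using (_^_; ^-homo-*; ^-assocʳ; ^-distrib-*)
open import Relation.Nullary using (¬_; does; yes; no)
open import Relation.Nullary.Decidable using (toWitness)
open import Relation.Unary using (Decidable)
open import Relation.Binary.Definitions using (tri<; tri≈; tri>)
open import Relation.Binary.PropositionalEquality

∧-true : ∀ a {b} → a ∧ b ≡ true → a ≡ true × b ≡ true
∧-true true b≡true = refl , b≡true

∨-true : ∀ {a b} → a ∨ b ≡ true → a ≡ true ⊎ b ≡ true
∨-true {true}  _      = inj₁ refl
∨-true {false} b≡true = inj₂ b≡true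

∨-false : ∀ a {b} → a ∨ b ≡ false → a ≡ false × b ≡ false
∨-false false b≡false = refl , b≡false

∨-intro : ∀ {a b} → a ≡ true ⊎ b ≡ true → a ∨ b ≡ true
∨-intro (inj₁ refl) = refl
∨-intro {a} (inj₂ refl) = Bool.∨-zeroʳ a

not-true : ∀ {a} → not a ≡ true → a ≡ false
not-true {false} _ = refl

false≢true : false ≢ true
false≢true ()

⇒ᵇ-elim : ∀ {a b} → (a ⇒ᵇ b) ≡ true → a ≡ true → b ≡ true
⇒ᵇ-elim a⇒b refl = a⇒b

anyFin-witness : ∀ {n} (f : Fin n → Bool) → anyFin f ≡ true → ∃ λ k → f k ≡ true
anyFin-witness {suc n} f eq with f Fin.zero in e
... | true  = Fin.zero , e
... | false = let k , p = anyFin-witness (f ∘ Fin.suc) eq in Fin.suc k , p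

anyFin-intro : ∀ {n} (f : Fin n → Bool) k → f k ≡ true → anyFin f ≡ true
anyFin-intro f Fin.zero    e rewrite e = refl
anyFin-intro f (Fin.suc k) e rewrite anyFin-intro (f ∘ Fin.suc) k e = Bool.∨-zeroʳ (f Fin.zero)

anyFin-false : ∀ {n} (f : Fin n → Bool) → (∀ k → f k ≡ false) → anyFin f ≡ false
anyFin-false {zero}  f h = refl
anyFin-false {suc n} f h rewrite h Fin.zero = anyFin-false (f ∘ Fin.suc) (h ∘ Fin.suc)

allFin-elim : ∀ {n} (f : Fin n → Bool) → allFin f ≡ true → ∀ k → f k ≡ true
allFin-elim f eq k with f k in e
... | true  = refl
... | false with trans (sym eq) (cong not (anyFin-intro (not ∘ f) k (cong not e)))
... | ()

allFin-counterexample : ∀ {n} (f : Fin n → Bool) → allFin f ≡ false → ∃ λ k → f k ≡ false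
allFin-counterexample f eq with anyFin (not ∘ f) in e
... | true = let k , p = anyFin-witness (not ∘ f) e in k , Bool.not-injective p
allFin-counterexample f () | false

allFin-false : ∀ {n} (f : Fin n → Bool) k → f k ≡ false → allFin f ≡ false
allFin-false f k e rewrite anyFin-intro (not ∘ f) k (cong not e) = refl

anyFin-cong : ∀ {n} {f g : Fin n → Bool} → f ≗ g → anyFin f ≡ anyFin g
anyFin-cong {zero}  h = refl
anyFin-cong {suc n} h = cong₂ _∨_ (h Fin.zero) (anyFin-cong (h ∘ Fin.suc))

allFin-cong : ∀ {n} {f g : Fin n → Bool} → f ≗ g → allFin f ≡ allFin g
allFin-cong h = cong not (anyFin-cong (cong not ∘ h))

==-sound : ∀ {n} (x y : Fin n) → (x == y) ≡ true → x ≡ y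
==-sound x y e with x ≟ y
... | yes p = p

==-refl : ∀ {n} (x : Fin n) → (x == x) ≡ true
==-refl x with x ≟ x
... | yes _ = refl
... | no ¬p = ⊥-elim (¬p refl)

==-false : ∀ {n} {x y : Fin n} → x ≢ y → (x == y) ≡ false
==-false {x = x} {y} x≢y with x ≟ y
... | yes p = ⊥-elim (x≢y p)
... | no _  = refl

Assignment : ℕ → Set
Assignment n = Fin n → Bool

sumAll : ∀ n → (Assignment n → ℚ) → ℚ
sumAll n f = sumℚ (map f (allAssignments n))

Congruent : ∀ {n} → (Assignment n → ℚ) → Set
Congruent f = ∀ A B → A ≗ B → f A ≡ f B

sumℚ-++ : ∀ xs ys → sumℚ (xs ++ ys) ≡ sumℚ xs +ℚ sumℚ ys
sumℚ-++ []       ys = sym (ℚ.+-identityˡ _)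
sumℚ-++ (x ∷ xs) ys = trans (cong (x +ℚ_) (sumℚ-++ xs ys)) (sym (ℚ.+-assoc x _ _))

sumAll-cong : ∀ {n} {f g : Assignment n → ℚ} → f ≗ g → sumAll n f ≡ sumAll n g
sumAll-cong {n} h = cong sumℚ (List.map-cong h (allAssignments n))

sumAll-+ : ∀ {n} (f g : Assignment n → ℚ) → sumAll n (λ A → f A +ℚ g A) ≡ sumAll n f +ℚ sumAll n g
sumAll-+ {n} f g = go (allAssignments n)
  where
  go : ∀ As → sumℚ (map (λ A → f A +ℚ g A) As) ≡ sumℚ (map f As) +ℚ sumℚ (map g As)
  go []       = sym (ℚ.+-identityˡ 0ℚ)
  go (A ∷ As) = trans (cong (f A +ℚ g A +ℚ_) (go As)) (interchange (f A) (g A) _ _)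

sumAll-mono : ∀ {n} {f g : Assignment n → ℚ} → (∀ A → f A ≤ℚ g A) → sumAll n f ≤ℚ sumAll n g
sumAll-mono {n} h = go (allAssignments n)
  where
  go : ∀ As → sumℚ (map _ As) ≤ℚ sumℚ (map _ As)
  go []       = ℚ.≤-refl
  go (A ∷ As) = ℚ.+-mono-≤ (h A) (go As)

sumAll-nonNeg : ∀ {n} (f : Assignment n → ℚ) → (∀ A → 0ℚ ≤ℚ f A) → 0ℚ ≤ℚ sumAll n f
sumAll-nonNeg {n} f h = ℚ.≤-trans (ℚ.≤-reflexive (sym (sumAll-zero (allAssignments n)))) (sumAll-mono h)
  where
  sumAll-zero : ∀ As → sumℚ (map (λ _ → 0ℚ) As) ≡ 0ℚ
  sumAll-zero []       = refl
  sumAll-zero (A ∷ As) = trans (ℚ.+-identityˡ _) (sumAll-zero As)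

-- allAssignments extends A by anonymous pattern lambdas, which agree with b ∷ᵛ A only
-- pointwise; hence the congruence hypothesis.
sumAll-suc : ∀ {n} (f : Assignment (suc n) → ℚ) → Congruent f →
  sumAll (suc n) f ≡ sumAll n (f ∘ (false ∷ᵛ_)) +ℚ sumAll n (f ∘ (true ∷ᵛ_))
sumAll-suc {n} f f-cong = split _ _ (λ _ → λ { Fin.zero → refl ; (Fin.suc _) → refl })
                                    (λ _ → λ { Fin.zero → refl ; (Fin.suc _) → refl })
  where
  As = allAssignments n
  half : ∀ (g : Assignment n → Assignment (suc n)) b → (∀ A → g A ≗ b ∷ᵛ A) →
         sumℚ (map f (map g As)) ≡ sumAll n (f ∘ (b ∷ᵛ_))
  half g b h = trans (cong sumℚ (sym (List.map-∘ As))) (sumAll-cong λ A → f-cong _ _ (h A))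
  split : ∀ g₀ g₁ → (∀ A → g₀ A ≗ false ∷ᵛ A) → (∀ A → g₁ A ≗ true ∷ᵛ A) →
          sumℚ (map f (map g₀ As ++ map g₁ As)) ≡ sumAll n (f ∘ (false ∷ᵛ_)) +ℚ sumAll n (f ∘ (true ∷ᵛ_))
  split g₀ g₁ h₀ h₁ = trans (cong sumℚ (List.map-++ f (map g₀ As) _))
    (trans (sumℚ-++ (map f (map g₀ As)) _) (cong₂ _+ℚ_ (half g₀ false h₀) (half g₁ true h₁)))

flipAt : ∀ {n} → Fin n → Assignment n → Assignment n
flipAt c A = updateAt A c not

flipAt-cong : ∀ {n} (c : Fin n) {A B : Assignment n} → A ≗ B → flipAt c A ≗ flipAt c B
flipAt-cong Fin.zero    h Fin.zero    = cong not (h Fin.zero)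
flipAt-cong Fin.zero    h (Fin.suc v) = h (Fin.suc v)
flipAt-cong (Fin.suc c) h Fin.zero    = h Fin.zero
flipAt-cong (Fin.suc c) h (Fin.suc v) = flipAt-cong c (h ∘ Fin.suc) v

sumAll-flipAt : ∀ {n} (f : Assignment n → ℚ) → Congruent f → (c : Fin n) →
  sumAll n (f ∘ flipAt c) ≡ sumAll n f
sumAll-flipAt {suc n} f f-cong Fin.zero = begin
  sumAll (suc n) (f ∘ flipAt Fin.zero)
    ≡⟨ sumAll-suc (f ∘ flipAt Fin.zero) (λ A B h → f-cong _ _ (flipAt-cong Fin.zero h)) ⟩
  sumAll n (f ∘ flipAt Fin.zero ∘ (false ∷ᵛ_)) +ℚ sumAll n (f ∘ flipAt Fin.zero ∘ (true ∷ᵛ_))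
    ≡⟨ cong₂ _+ℚ_ (sumAll-cong λ A → f-cong _ (true ∷ᵛ A) λ { Fin.zero → refl ; (Fin.suc _) → refl })
                  (sumAll-cong λ A → f-cong _ (false ∷ᵛ A) λ { Fin.zero → refl ; (Fin.suc _) → refl }) ⟩
  sumAll n (f ∘ (true ∷ᵛ_)) +ℚ sumAll n (f ∘ (false ∷ᵛ_))
    ≡⟨ ℚ.+-comm (sumAll n (f ∘ (true ∷ᵛ_))) _ ⟩
  sumAll n (f ∘ (false ∷ᵛ_)) +ℚ sumAll n (f ∘ (true ∷ᵛ_))
    ≡⟨ sym (sumAll-suc f f-cong) ⟩
  sumAll (suc n) f ∎
  where open ≡-Reasoning
sumAll-flipAt {suc n} f f-cong (Fin.suc c) = begin
  sumAll (suc n) (f ∘ flipAt (Fin.suc c))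
    ≡⟨ sumAll-suc (f ∘ flipAt (Fin.suc c)) (λ A B h → f-cong _ _ (flipAt-cong (Fin.suc c) h)) ⟩
  sumAll n (f ∘ flipAt (Fin.suc c) ∘ (false ∷ᵛ_)) +ℚ sumAll n (f ∘ flipAt (Fin.suc c) ∘ (true ∷ᵛ_))
    ≡⟨ cong₂ _+ℚ_ (shift false) (shift true) ⟩
  sumAll n (f ∘ (false ∷ᵛ_)) +ℚ sumAll n (f ∘ (true ∷ᵛ_))
    ≡⟨ sym (sumAll-suc f f-cong) ⟩
  sumAll (suc n) f ∎
  where
  open ≡-Reasoning
  shift : ∀ b → sumAll n (f ∘ flipAt (Fin.suc c) ∘ (b ∷ᵛ_)) ≡ sumAll n (f ∘ (b ∷ᵛ_))
  shift b = trans (sumAll-cong λ A → f-cong _ (b ∷ᵛ flipAt c A) λ { Fin.zero → refl ; (Fin.suc _) → refl })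
                  (sumAll-flipAt (f ∘ (b ∷ᵛ_)) (λ A B h → f-cong _ _ λ { Fin.zero → refl ; (Fin.suc v) → h v }) c)

-- The second step holds by computation: ⅔ · 3 normalises to 1 + 1.
z+z≡⅔[z+z+z] : ∀ z → z +ℚ z ≡ twoThirds *ℚ ((z +ℚ z) +ℚ z)
z+z≡⅔[z+z+z] z = sym (begin
  twoThirds *ℚ ((z +ℚ z) +ℚ z)         ≡⟨ cong (twoThirds *ℚ_) triple ⟩
  twoThirds *ℚ (((1ℚ +ℚ 1ℚ) +ℚ 1ℚ) *ℚ z) ≡⟨ sym (ℚ.*-assoc twoThirds ((1ℚ +ℚ 1ℚ) +ℚ 1ℚ) z) ⟩
  (1ℚ +ℚ 1ℚ) *ℚ z                      ≡⟨ double ⟩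
  z +ℚ z                               ∎)
  where
  open ≡-Reasoning
  double : (1ℚ +ℚ 1ℚ) *ℚ z ≡ z +ℚ z
  double = trans (ℚ.*-distribʳ-+ z 1ℚ 1ℚ) (cong₂ _+ℚ_ (ℚ.*-identityˡ z) (ℚ.*-identityˡ z))
  triple : (z +ℚ z) +ℚ z ≡ ((1ℚ +ℚ 1ℚ) +ℚ 1ℚ) *ℚ z
  triple = sym (trans (ℚ.*-distribʳ-+ z (1ℚ +ℚ 1ℚ) 1ℚ) (cong₂ _+ℚ_ double (ℚ.*-identityˡ z)))

-- The weight where a is true splits into the regions (a,b) = (1,0) and (1,1), the total
-- weight into (1,0), (0,1) and (1,1); flipping b (resp. a) maps (1,1) onto (1,0) (resp.
-- (0,1)) without changing f, so the three regions carry the same weight.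
sumAll-ifTrue≡⅔ : ∀ {n} (f : Assignment n → ℚ) → Congruent f → {a b : Fin n} → a ≢ b →
  (∀ A → A a ≡ false → A b ≡ false → f A ≡ 0ℚ) →
  (∀ A → A b ≡ true → f (flipAt a A) ≡ f A) →
  (∀ A → A a ≡ true → f (flipAt b A) ≡ f A) →
  sumAll n (λ A → if A a then f A else 0ℚ) ≡ twoThirds *ℚ sumAll n f
sumAll-ifTrue≡⅔ {n} f f-cong {a} {b} a≢b f-vanishes flipA-invariant flipB-invariant = begin
  sumAll n (λ A → if A a then f A else 0ℚ)                           ≡⟨ ifTrue≡2both ⟩
  sumAll n both +ℚ sumAll n both                                     ≡⟨ z+z≡⅔[z+z+z] (sumAll n both) ⟩
  twoThirds *ℚ ((sumAll n both +ℚ sumAll n both) +ℚ sumAll n both)   ≡⟨ cong (twoThirds *ℚ_) (sym f≡3both) ⟩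
  twoThirds *ℚ sumAll n f                                            ∎
  where
  open ≡-Reasoning
  both onlyA onlyB : Assignment n → ℚ
  both  A = if A a then (if A b then f A else 0ℚ) else 0ℚ
  onlyA A = if A a then (if A b then 0ℚ else f A) else 0ℚ
  onlyB A = if A a then 0ℚ else (if A b then f A else 0ℚ)

  both-cong : Congruent both
  both-cong A B h rewrite h a | h b | f-cong A B h = refl

  onlyA≡both : sumAll n onlyA ≡ sumAll n both
  onlyA≡both = trans (sumAll-cong (sym ∘ flipB)) (sumAll-flipAt both both-cong b)
    where
    flipB : ∀ A → both (flipAt b A) ≡ onlyA A
    flipB A rewrite updateAt-minimal a b {not} A a≢b | updateAt-updates b {not} A with A a in ea | A b
    ... | false | _     = refl
    ... | true  | true  = refl
    ... | true  | false = flipB-invariant A ea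

  onlyB≡both : sumAll n onlyB ≡ sumAll n both
  onlyB≡both = trans (sumAll-cong (sym ∘ flipA)) (sumAll-flipAt both both-cong a)
    where
    flipA : ∀ A → both (flipAt a A) ≡ onlyB A
    flipA A rewrite updateAt-minimal b a {not} A (a≢b ∘ sym) | updateAt-updates a {not} A with A a | A b in eb
    ... | true  | _     = refl
    ... | false | false = refl
    ... | false | true  = flipA-invariant A eb

  f-split : ∀ A → f A ≡ (onlyA A +ℚ onlyB A) +ℚ both A
  f-split A with A a in ea | A b in eb
  ... | true  | true  = sym (trans (cong (_+ℚ f A) (ℚ.+-identityʳ 0ℚ)) (ℚ.+-identityˡ (f A)))
  ... | true  | false = sym (trans (ℚ.+-identityʳ _) (ℚ.+-identityʳ _))
  ... | false | true  = sym (trans (ℚ.+-identityʳ _) (ℚ.+-identityˡ _))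
  ... | false | false = f-vanishes A ea eb

  ifTrue-split : ∀ A → (if A a then f A else 0ℚ) ≡ onlyA A +ℚ both A
  ifTrue-split A with A a | A b
  ... | true  | true  = sym (ℚ.+-identityˡ _)
  ... | true  | false = sym (ℚ.+-identityʳ _)
  ... | false | _     = refl

  ifTrue≡2both : sumAll n (λ A → if A a then f A else 0ℚ) ≡ sumAll n both +ℚ sumAll n both
  ifTrue≡2both = trans (sumAll-cong ifTrue-split)
    (trans (sumAll-+ onlyA both) (cong (_+ℚ sumAll n both) onlyA≡both))

  f≡3both : sumAll n f ≡ (sumAll n both +ℚ sumAll n both) +ℚ sumAll n both
  f≡3both = trans (sumAll-cong f-split) (trans (sumAll-+ (λ A → onlyA A +ℚ onlyB A) both)
    (cong (_+ℚ sumAll n both) (trans (sumAll-+ onlyA onlyB) (cong₂ _+ℚ_ onlyA≡both onlyB≡both))))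

powℚ≡^ : ∀ x k → powℚ x k ≡ x ^ k
powℚ≡^ x zero    = refl
powℚ≡^ x (suc k) = cong (x *ℚ_) (powℚ≡^ x k)

powℚ-+ : ∀ x a b → powℚ x (a + b) ≡ powℚ x a *ℚ powℚ x b
powℚ-+ x a b rewrite powℚ≡^ x (a + b) | powℚ≡^ x a | powℚ≡^ x b = ^-homo-* x a b

powℚ-distrib-* : ∀ x y k → powℚ (x *ℚ y) k ≡ powℚ x k *ℚ powℚ y k
powℚ-distrib-* x y k rewrite powℚ≡^ (x *ℚ y) k | powℚ≡^ x k | powℚ≡^ y k = ^-distrib-* x y k

powℚ-powℚ : ∀ x r q → powℚ (powℚ x r) q ≡ powℚ x (r * q)
powℚ-powℚ x r q rewrite powℚ≡^ (powℚ x r) q | powℚ≡^ x r | powℚ≡^ x (r * q) = ^-assocʳ x r q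

powℚ-nonNeg : ∀ {x} → 0ℚ ≤ℚ x → ∀ k → 0ℚ ≤ℚ powℚ x k
powℚ-nonNeg 0≤x zero    = toWitness {a? = 0ℚ ℚ.≤? 1ℚ} _
powℚ-nonNeg {x} 0≤x (suc k) = ℚ.nonNegative⁻¹ (x *ℚ powℚ x k)
  {{ℚ.nonNeg*nonNeg⇒nonNeg x {{ℚ.nonNegative 0≤x}} _ {{ℚ.nonNegative (powℚ-nonNeg 0≤x k)}}}}

powℚ-monoˡ-≤ : ∀ {x y} → 0ℚ ≤ℚ x → x ≤ℚ y → ∀ k → powℚ x k ≤ℚ powℚ y k
powℚ-monoˡ-≤ 0≤x x≤y zero    = ℚ.≤-refl
powℚ-monoˡ-≤ {x} {y} 0≤x x≤y (suc k) = ℚ.≤-trans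
  (ℚ.*-monoʳ-≤-nonNeg (powℚ x k) {{ℚ.nonNegative (powℚ-nonNeg 0≤x k)}} x≤y)
  (ℚ.*-monoˡ-≤-nonNeg y {{ℚ.nonNegative (ℚ.≤-trans 0≤x x≤y)}} (powℚ-monoˡ-≤ 0≤x x≤y k))

powℚ≤1 : ∀ {x} → 0ℚ ≤ℚ x → x ≤ℚ 1ℚ → ∀ k → powℚ x k ≤ℚ 1ℚ
powℚ≤1 0≤x x≤1 k = ℚ.≤-trans (powℚ-monoˡ-≤ 0≤x x≤1 k) (ℚ.≤-reflexive (powℚ-1 k))
  where
  powℚ-1 : ∀ k → powℚ 1ℚ k ≡ 1ℚ
  powℚ-1 zero    = refl
  powℚ-1 (suc k) = trans (ℚ.*-identityˡ _) (powℚ-1 k)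

powℚ-antiʳ-≤ : ∀ {x} → 0ℚ ≤ℚ x → x ≤ℚ 1ℚ → ∀ {a b} → a ≤ b → powℚ x b ≤ℚ powℚ x a
powℚ-antiʳ-≤ {x} 0≤x x≤1 {a} a≤b with ℕ.m≤n⇒∃[o]m+o≡n a≤b
... | d , refl = begin
  powℚ x (a + d)        ≡⟨ powℚ-+ x a d ⟩
  powℚ x a *ℚ powℚ x d  ≤⟨ ℚ.*-monoˡ-≤-nonNeg (powℚ x a) {{ℚ.nonNegative (powℚ-nonNeg 0≤x a)}} (powℚ≤1 0≤x x≤1 d) ⟩
  powℚ x a *ℚ 1ℚ        ≡⟨ ℚ.*-identityʳ _ ⟩
  powℚ x a              ∎
  where open ℚ.≤-Reasoning

powℚ-bound : ∀ {X Y c} r q a → 0ℚ ≤ℚ X → 0ℚ ≤ℚ Y → 0ℚ ≤ℚ c → c ≤ℚ 1ℚ →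
             X ≤ℚ powℚ c r *ℚ Y → a ≤ r * q → powℚ X q ≤ℚ powℚ c a *ℚ powℚ Y q
powℚ-bound {X} {Y} {c} r q a 0≤X 0≤Y 0≤c c≤1 X≤cʳY a≤rq = begin
  powℚ X q                         ≤⟨ powℚ-monoˡ-≤ 0≤X X≤cʳY q ⟩
  powℚ (powℚ c r *ℚ Y) q           ≡⟨ powℚ-distrib-* (powℚ c r) Y q ⟩
  powℚ (powℚ c r) q *ℚ powℚ Y q    ≡⟨ cong (_*ℚ powℚ Y q) (powℚ-powℚ c r q) ⟩
  powℚ c (r * q) *ℚ powℚ Y q       ≤⟨ ℚ.*-monoʳ-≤-nonNeg (powℚ Y q) {{ℚ.nonNegative (powℚ-nonNeg 0≤Y q)}}
                                        (powℚ-antiʳ-≤ 0≤c c≤1 a≤rq) ⟩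
  powℚ c a *ℚ powℚ Y q             ∎
  where open ℚ.≤-Reasoning

length-filter-cong : ∀ {X : Set} {f g : X → Bool} → f ≗ g → ∀ xs →
  length (filter (λ x → f x Bool.≟ true) xs) ≡ length (filter (λ x → g x Bool.≟ true) xs)
length-filter-cong f≗g []       = refl
length-filter-cong {g = g} f≗g (x ∷ xs) rewrite f≗g x with g x
... | true  = cong suc (length-filter-cong f≗g xs)
... | false = length-filter-cong f≗g xs

length-filter-map : ∀ {X Y : Set} (f : Y → Bool) (g : X → Y) xs →
  length (filter (λ x → f (g x) Bool.≟ true) xs) ≡ length (filter (λ y → f y Bool.≟ true) (map g xs))
length-filter-map f g []       = refl
length-filter-map f g (x ∷ xs) with f (g x)
... | true  = cong suc (length-filter-map f g xs)
... | false = length-filter-map f g xs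

map-lookup-allFin : ∀ {X : Set} (xs : List X) → map (lookup xs) (List.allFin (length xs)) ≡ xs
map-lookup-allFin xs = trans (List.map-tabulate id (lookup xs)) (List.tabulate-lookup xs)

least : (P : ℕ → Set) → Decidable P → ∀ K → P K →
        ∃ λ d → P d × d ≤ K × (∀ t → t < d → ¬ P t)
least P P? K pK with P? 0
... | yes p0 = 0 , p0 , z≤n , λ _ ()
least P P? zero    pK | no ¬p0 = ⊥-elim (¬p0 pK)
least P P? (suc K) pK | no ¬p0 with least (P ∘ suc) (P? ∘ suc) K pK
... | d , pd , d≤K , below = suc d , pd , s≤s d≤K , λ { zero _ → ¬p0 ; (suc t) t<d → below t (ℕ.s<s⁻¹ t<d) }

iter-+ : ∀ {A : Set} (f : A → A) a b x → iter f (a + b) x ≡ iter f a (iter f b x)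
iter-+ f zero    b x = refl
iter-+ f (suc a) b x = cong f (iter-+ f a b x)

module RootedTrees {n m : ℕ} (G : TreeFamily n m) (BT : IsBTGraph G) where
  open TreeFamily G
  open IsBTGraph BT

  iter-par-inT : ∀ {i v} → inT i v ≡ true → ∀ k → inT i (iter (par i) k v) ≡ true
  iter-par-inT v∈Tᵢ zero    = v∈Tᵢ
  iter-par-inT v∈Tᵢ (suc k) = parIn _ _ (iter-par-inT v∈Tᵢ k)

  -- The least such d makes k ↦ par^k v injective on {0,…,d}, whence d < n.
  pathToRoot : ∀ {i v} → inT i v ≡ true → ∃ λ d → d < n × iter (par i) d v ≡ root i
  pathToRoot {i} {v} v∈Tᵢ with reach i v v∈Tᵢ
  ... | K , pK with least (λ t → iter (par i) t v ≡ root i) (λ t → iter (par i) t v ≟ root i) K pK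
  ... | d , pd , _ , below = d , injective⇒≤ {f = ancestor} ancestor-injective , pd
    where
    ancestor : Fin (suc d) → Fin n
    ancestor k = iter (par i) (toℕ k) v
    no-repeat : ∀ {s t} → s < t → t ≤ d → iter (par i) s v ≢ iter (par i) t v
    no-repeat {s} {t} s<t t≤d eq with ℕ.m≤n⇒∃[o]m+o≡n t≤d
    ... | e , refl = below (e + s) (subst (_< t + e) (ℕ.+-comm s e) (ℕ.+-monoˡ-< e s<t)) (begin
      iter (par i) (e + s) v           ≡⟨ iter-+ (par i) e s v ⟩
      iter (par i) e (iter (par i) s v) ≡⟨ cong (iter (par i) e) eq ⟩
      iter (par i) e (iter (par i) t v) ≡⟨ sym (iter-+ (par i) e t v) ⟩
      iter (par i) (e + t) v           ≡⟨ cong (λ z → iter (par i) z v) (ℕ.+-comm e t) ⟩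
      iter (par i) (t + e) v           ≡⟨ pd ⟩
      root i                           ∎)
      where open ≡-Reasoning
    ancestor-injective : ∀ {x y} → ancestor x ≡ ancestor y → x ≡ y
    ancestor-injective {x} {y} eq with ℕ.<-cmp (toℕ x) (toℕ y)
    ... | tri< x<y _ _ = ⊥-elim (no-repeat x<y (ℕ.s≤s⁻¹ (toℕ<n y)) eq)
    ... | tri≈ _ x≡y _ = toℕ-injective x≡y
    ... | tri> _ _ y<x = ⊥-elim (no-repeat y<x (ℕ.s≤s⁻¹ (toℕ<n x)) (sym eq))

  onPath-intro : ∀ {i ℓ u} d → d < n → inT i u ≡ true → iter (par i) d ℓ ≡ u →
                 onPathToRoot G i ℓ u ≡ true
  onPath-intro {i} {ℓ} {u} d d<n u∈Tᵢ eq rewrite u∈Tᵢ =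
    anyFin-intro (λ k → iter (par i) (toℕ k) ℓ == u) (Fin.fromℕ< d<n)
      (subst (λ z → (iter (par i) z ℓ == u) ≡ true) (sym (toℕ-fromℕ< d<n))
        (subst (λ z → (z == u) ≡ true) (sym eq) (==-refl u)))

  onPath-elim : ∀ {i ℓ u} → onPathToRoot G i ℓ u ≡ true →
                inT i u ≡ true × ∃ λ d → d < n × iter (par i) d ℓ ≡ u
  onPath-elim {i} {ℓ} {u} on with ∧-true (inT i u) on
  ... | u∈Tᵢ , found with anyFin-witness (λ k → iter (par i) (toℕ k) ℓ == u) found
  ... | k , eq = u∈Tᵢ , toℕ k , toℕ<n k , ==-sound _ u eq

  onPath-root : ∀ {i v} → inT i v ≡ true → onPathToRoot G i v (root i) ≡ true
  onPath-root {i} v∈Tᵢ with pathToRoot v∈Tᵢ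
  ... | d , d<n , eq = onPath-intro d d<n (rootIn i) eq

  onPath-self : ∀ {i v} → inT i v ≡ true → onPathToRoot G i v v ≡ true
  onPath-self {v = v} v∈Tᵢ = onPath-intro 0 (ℕ.≤-<-trans z≤n (toℕ<n v)) v∈Tᵢ refl

  isLeaf-parts : ∀ {i v} → isLeaf G i v ≡ true →
                 inT i v ≡ true × (v == root i) ≡ false × anyFin (λ u → isChild G i u v) ≡ false
  isLeaf-parts {i} {v} leaf with ∧-true (inT i v) leaf
  ... | v∈Tᵢ , rest with ∧-true (not (v == root i)) rest
  ... | v≢root , childless = v∈Tᵢ , not-true v≢root , not-true childless

  isLeaf-inT : ∀ {i v} → isLeaf G i v ≡ true → inT i v ≡ true
  isLeaf-inT = proj₁ ∘ isLeaf-parts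

  isLeaf-nonRoot : ∀ {i v} → isLeaf G i v ≡ true → v ≢ root i
  isLeaf-nonRoot {i} leaf refl = false≢true (trans (sym (proj₁ (proj₂ (isLeaf-parts leaf)))) (==-refl (root i)))

  isLeaf-childless : ∀ {i v u} → isLeaf G i v ≡ true → inT i u ≡ true → u ≢ root i → par i u ≢ v
  isLeaf-childless {i} {v} {u} leaf u∈Tᵢ u≢root refl =
    false≢true (trans (sym (proj₂ (proj₂ (isLeaf-parts leaf)))) (anyFin-intro (λ w → isChild G i w v) u child))
    where
    child : isChild G i u v ≡ true
    child rewrite u∈Tᵢ | ==-false u≢root | ==-refl (par i u) = refl

  root-unique : ∀ {i k} → inT k (root i) ≡ true → k ≡ i
  root-unique {i} {k} root∈Tₖ with k ≟ i
  ... | yes k≡i = k≡i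
  ... | no k≢i = ⊥-elim (isLeaf-nonRoot (proj₁ (shareLeaf i k (k≢i ∘ sym) (root i) (rootIn i) root∈Tₖ)) refl)

  root-injective : ∀ {t s} → root t ≡ root s → t ≡ s
  root-injective {t} {s} eq = sym (root-unique (subst (λ z → inT s z ≡ true) (sym eq) (rootIn s)))

  rootVar-inT : ∀ {i v} → isRootVar G v ≡ true → inT i v ≡ true → v ≡ root i
  rootVar-inT {i} {v} rootVar v∈Tᵢ with anyFin-witness (λ k → root k == v) rootVar
  ... | k , eq with ==-sound (root k) v eq
  ... | refl = cong root (sym (root-unique v∈Tᵢ))

  isLeaf-notRootVar : ∀ {i v} → isLeaf G i v ≡ true → isRootVar G v ≡ false
  isLeaf-notRootVar {i} {v} leaf with isRootVar G v in rootVar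
  ... | false = refl
  ... | true  = ⊥-elim (isLeaf-nonRoot leaf (rootVar-inT rootVar (isLeaf-inT leaf)))

  isInternal-notLeafVar : ∀ {x} → isInternal G x ≡ true → isLeafVar G x ≡ false
  isInternal-notLeafVar {x} internal = not-true (proj₂ (∧-true (not (isRootVar G x)) internal))

  -- A vertex with a sibling in Tᵢ is no leaf of Tᵢ (Tᵢ is extended), hence shared with no
  -- other tree, hence neither a leaf nor a root of any tree.
  sibling-isInternal : ∀ {i x y} → inT i x ≡ true → inT i y ≡ true → x ≢ root i → y ≢ root i →
                       x ≢ y → par i x ≡ par i y → isInternal G x ≡ true
  sibling-isInternal {i} {x} {y} x∈Tᵢ y∈Tᵢ x≢root y≢root x≢y pe =
    cong₂ (λ a b → not a ∧ not b) (anyFin-false _ notRoot) (anyFin-false _ notLeaf)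
    where
    notLeafᵢ : isLeaf G i x ≢ true
    notLeafᵢ leaf = leafNoSibling i x y leaf y∈Tᵢ y≢root (x≢y ∘ sym) (sym pe)
    onlyInTᵢ : ∀ {k} → inT k x ≡ true → k ≡ i
    onlyInTᵢ {k} x∈Tₖ with k ≟ i
    ... | yes k≡i = k≡i
    ... | no k≢i  = ⊥-elim (notLeafᵢ (proj₁ (shareLeaf i k (k≢i ∘ sym) x x∈Tᵢ x∈Tₖ)))
    notRoot : ∀ k → (root k == x) ≡ false
    notRoot k with root k ≟ x
    ... | no _     = refl
    ... | yes refl with onlyInTᵢ (rootIn k)
    ... | refl = ⊥-elim (x≢root refl)
    notLeaf : ∀ k → isLeaf G k x ≡ false
    notLeaf k with isLeaf G k x in leaf
    ... | false = refl
    ... | true with onlyInTᵢ (isLeaf-inT leaf)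
    ... | refl = ⊥-elim (notLeafᵢ leaf)

  isSibling-intro : ∀ {i x y} → inT i x ≡ true → inT i y ≡ true → x ≢ root i → y ≢ root i →
                    x ≢ y → par i x ≡ par i y → isSibling G x y ≡ true
  isSibling-intro {i} {x} {y} x∈Tᵢ y∈Tᵢ x≢root y≢root x≢y pe
    rewrite sibling-isInternal x∈Tᵢ y∈Tᵢ x≢root y≢root x≢y pe
          | sibling-isInternal y∈Tᵢ x∈Tᵢ y≢root x≢root (x≢y ∘ sym) (sym pe)
          | ==-false (x≢y ∘ sym) =
    anyFin-intro (λ k → inT k x ∧ inT k y ∧ (par k y == par k x)) i
      (subst (λ z → inT i x ∧ inT i y ∧ (z == par i x) ≡ true) pe
        (subst₂ (λ a b → a ∧ b ∧ (par i x == par i x) ≡ true) (sym x∈Tᵢ) (sym y∈Tᵢ) (==-refl (par i x))))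

  childTowards : ∀ {i ℓ w} → inT i ℓ ≡ true → onPathToRoot G i ℓ w ≡ true → w ≢ ℓ →
                 ∃ λ c → onPathToRoot G i ℓ c ≡ true × c ≢ root i × par i c ≡ w
  childTowards {i} {ℓ} {w} ℓ∈Tᵢ on w≢ℓ with onPath-elim on
  ... | _ , s₀ , s₀<n , eq₀ with least (λ s → iter (par i) s ℓ ≡ w) (λ s → iter (par i) s ℓ ≟ w) s₀ eq₀
  ... | zero , eq , _ , _ = ⊥-elim (w≢ℓ (sym eq))
  ... | suc s , eq , s<s₀ , below =
    c , onPath-intro s (ℕ.<-≤-trans s<s₀ (ℕ.<⇒≤ s₀<n)) (iter-par-inT ℓ∈Tᵢ s) refl , c≢root , eq
    where
    c = iter (par i) s ℓ
    c≢root : c ≢ root i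
    c≢root c≡root = below s (ℕ.n<1+n s) (trans c≡root (trans (sym (parRoot i)) (trans (cong (par i) (sym c≡root)) eq)))

  leaf-notOnOtherPath : ∀ {i ℓ ℓ′} → isLeaf G i ℓ ≡ true → isLeaf G i ℓ′ ≡ true → ℓ ≢ ℓ′ →
                        onPathToRoot G i ℓ ℓ′ ≢ true
  leaf-notOnOtherPath leafℓ leafℓ′ ℓ≢ℓ′ ℓ′-on with childTowards (isLeaf-inT leafℓ) ℓ′-on (ℓ≢ℓ′ ∘ sym)
  ... | c , c-on , c≢root , pc≡ℓ′ = isLeaf-childless leafℓ′ (proj₁ (onPath-elim c-on)) c≢root pc≡ℓ′

  offPath-nonRoot : ∀ {i ℓ x} → inT i ℓ ≡ true → onPathToRoot G i ℓ x ≢ true → x ≢ root i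
  offPath-nonRoot {i} {ℓ} ℓ∈Tᵢ x-off refl = x-off (onPath-root ℓ∈Tᵢ)

  offPath-sibling : ∀ {i ℓ ℓ′} → isLeaf G i ℓ ≡ true → isLeaf G i ℓ′ ≡ true → ∀ k → k < n →
    onPathToRoot G i ℓ (iter (par i) k ℓ′) ≢ true → onPathToRoot G i ℓ (iter (par i) (suc k) ℓ′) ≡ true →
    ∃₂ λ c u → onPathToRoot G i ℓ c ≡ true × isInternal G c ≡ true × isSibling G c u ≡ true ×
               onPathToRoot G i ℓ′ u ≡ true × u ≢ ℓ′
  offPath-sibling {i} {ℓ} {ℓ′} leafℓ leafℓ′ k k<n c′-off w-on
    with childTowards (isLeaf-inT leafℓ) w-on
           (isLeaf-childless leafℓ (iter-par-inT (isLeaf-inT leafℓ′) k) (offPath-nonRoot (isLeaf-inT leafℓ) c′-off))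
  ... | c , c-on , c≢root , pc≡w = c , c′ , c-on , internal-c , sibling , c′-on , c′≢ℓ′
    where
    c′ = iter (par i) k ℓ′
    c′∈Tᵢ = iter-par-inT (isLeaf-inT leafℓ′) k
    c∈Tᵢ = proj₁ (onPath-elim c-on)
    c′≢root = offPath-nonRoot (isLeaf-inT leafℓ) c′-off
    c≢c′ : c ≢ c′
    c≢c′ c≡c′ = c′-off (subst (λ z → onPathToRoot G i ℓ z ≡ true) c≡c′ c-on)
    internal-c = sibling-isInternal c∈Tᵢ c′∈Tᵢ c≢root c′≢root c≢c′ pc≡w
    internal-c′ = sibling-isInternal c′∈Tᵢ c∈Tᵢ c′≢root c≢root (c≢c′ ∘ sym) (sym pc≡w)
    sibling = isSibling-intro c∈Tᵢ c′∈Tᵢ c≢root c′≢root c≢c′ pc≡w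
    c′-on = onPath-intro k k<n c′∈Tᵢ refl
    c′≢ℓ′ : c′ ≢ ℓ′
    c′≢ℓ′ c′≡ℓ′ = false≢true (trans (sym (isInternal-notLeafVar internal-c′))
      (subst (λ z → isLeafVar G z ≡ true) (sym c′≡ℓ′) (anyFin-intro (λ k → isLeaf G k ℓ′) i leafℓ′)))

  -- For the least k with par^(k+1) ℓ′ on the path of ℓ, par^k ℓ′ is a sibling of a vertex of
  -- that path.
  otherLeaf-meetsSibling : ∀ {i ℓ ℓ′} → isLeaf G i ℓ ≡ true → isLeaf G i ℓ′ ≡ true → ℓ ≢ ℓ′ →
    ∃₂ λ c u → onPathToRoot G i ℓ c ≡ true × isInternal G c ≡ true × isSibling G c u ≡ true ×
               onPathToRoot G i ℓ′ u ≡ true × u ≢ ℓ′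
  otherLeaf-meetsSibling {i} {ℓ} {ℓ′} leafℓ leafℓ′ ℓ≢ℓ′ with pathToRoot (isLeaf-inT leafℓ′)
  ... | d′ , d′<n , reachesRoot
    with least (λ k → onPathToRoot G i ℓ (iter (par i) k ℓ′) ≡ true)
               (λ k → onPathToRoot G i ℓ (iter (par i) k ℓ′) Bool.≟ true) d′
               (subst (λ z → onPathToRoot G i ℓ z ≡ true) (sym reachesRoot) (onPath-root (isLeaf-inT leafℓ)))
  ... | zero  , ℓ′-on , _ , _ = ⊥-elim (leaf-notOnOtherPath leafℓ leafℓ′ ℓ≢ℓ′ ℓ′-on)
  ... | suc k , w-on , k<d′ , below =
    offPath-sibling leafℓ leafℓ′ k (ℕ.<-≤-trans k<d′ (ℕ.<⇒≤ d′<n)) (below k (ℕ.n<1+n k)) w-on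

module AssignmentFacts {n m : ℕ} (G : TreeFamily n m) where

  isPE-parts : ∀ i j ℓ → isPE G i j ℓ ≡ true → i ≢ j × isLeaf G i ℓ ≡ true × isLeaf G j ℓ ≡ true
  isPE-parts i j ℓ pe with ∧-true (not (i == j)) pe
  ... | i≠j , leaves with ∧-true (isLeaf G i ℓ) leaves
  ... | leafᵢ , leafⱼ = (λ { refl → false≢true (trans (sym (cong not (==-refl i))) i≠j) }) , leafᵢ , leafⱼ

  satClause-intro : ∀ {C : Fin n → Bool} A u → C u ≡ true → A u ≡ true → satClause G A C ≡ true
  satClause-intro {C} A u Cu Au = anyFin-intro (λ v → C v ∧ A v) u (cong₂ _∧_ Cu Au)

  satH-cong : ∀ {A B} → A ≗ B → satH G A ≡ satH G B
  satH-cong A≗B = allFin-cong λ i → allFin-cong λ j → allFin-cong λ ℓ →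
    cong (isPE G i j ℓ ⇒ᵇ_) (anyFin-cong λ v → cong (fullClause G (i , j , ℓ) v ∧_) (A≗B v))

  countFix-cong : ∀ {A B} → inFix G A ≗ inFix G B → countFix G A ≡ countFix G B
  countFix-cong fix≗ = length-filter-cong fix≗ (List.allFin n)

  inFix-cong : ∀ {A B} → A ≗ B → inFix G A ≗ inFix G B
  inFix-cong A≗B v = cong₂ _∧_ (A≗B v) (anyFin-cong λ i → anyFin-cong λ j → cong (isPE G i j v ∧_)
    (allFin-cong λ u → cong ((fullClause G (i , j , v) u ∧ not (u == v)) ⇒ᵇ_) (cong not (A≗B u))))

  satClause-flipAt-outside : ∀ {C : Fin n → Bool} {r} A → C r ≡ false →
                             satClause G (flipAt r A) C ≡ satClause G A C
  satClause-flipAt-outside {C} {r} A Cr = anyFin-cong same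
    where
    same : ∀ u → C u ∧ flipAt r A u ≡ C u ∧ A u
    same u with u ≟ r
    ... | yes refl rewrite Cr = refl
    ... | no u≢r rewrite updateAt-minimal u r {not} A u≢r = refl

  inFix-nonLeaf : ∀ {B v} → (∀ k → isLeaf G k v ≡ false) → inFix G B v ≡ false
  inFix-nonLeaf {B} {v} notLeaf = trans (cong (B v ∧_) (anyFin-false _ λ i → anyFin-false _ (noEdge i))) (Bool.∧-zeroʳ _)
    where
    noEdge : ∀ i j → isPE G i j v ∧ allFin (λ u → (fullClause G (i , j , v) u ∧ not (u == v)) ⇒ᵇ not (B u)) ≡ false
    noEdge i j rewrite notLeaf i with not (i == j)
    ... | true  = refl
    ... | false = refl

  weight-cong : ∀ {A B} → A ≗ B → weight G A ≡ weight G B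
  weight-cong A≗B = cong (λ k → powℚ ½ (n ∸ k)) (countFix-cong (inFix-cong A≗B))

  weight-nonNeg : ∀ b A → 0ℚ ≤ℚ (if b then weight G A else 0ℚ)
  weight-nonNeg true  A = powℚ-nonNeg (toWitness {a? = 0ℚ ℚ.≤? ½} _) (n ∸ countFix G A)
  weight-nonNeg false A = ℚ.≤-refl

  measure-nonNeg : ∀ P → 0ℚ ≤ℚ measure G P
  measure-nonNeg P = sumAll-nonNeg _ λ A → weight-nonNeg (satH G A ∧ P A) A

module Extensions {n m : ℕ} (G : TreeFamily n m) (S : Literals G) where

  isNeg-sound : ∀ {s} → isNeg G s ≡ true → s ≡ just false
  isNeg-sound {just false} _ = refl

  isPos-sound : ∀ {s} → isPos G s ≡ true → s ≡ just true
  isPos-sound {just true} _ = refl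

  compatible : Maybe Bool → Bool → Bool
  compatible nothing  _ = true
  compatible (just b) a = does (b Bool.≟ a)

  compatible-cong : ∀ {s a b} → s ≡ nothing ⊎ a ≡ b → compatible s a ≡ compatible s b
  compatible-cong (inj₁ refl) = refl
  compatible-cong (inj₂ refl) = refl

  extends-elim : ∀ {A} → extends G S A ≡ true → ∀ v → compatible (S v) (A v) ≡ true
  extends-elim {A} S⊆A v with S v | allFin-elim _ S⊆A v
  ... | nothing | _ = refl
  ... | just b  | p = p

  extends-intro : ∀ {A} → (∀ v → compatible (S v) (A v) ≡ true) → extends G S A ≡ true
  extends-intro {A} h with extends G S A in S⊆A
  ... | true  = refl
  ... | false with allFin-counterexample _ S⊆A
  ...   | v , p with S v | h v
  ...     | just b | q = ⊥-elim (false≢true (trans (sym p) q))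

  extends-cong : ∀ {A B} → (∀ v → S v ≡ nothing ⊎ A v ≡ B v) → extends G S A ≡ extends G S B
  extends-cong {A} {B} h with extends G S A in S⊆A | extends G S B in S⊆B
  ... | true  | true  = refl
  ... | false | false = refl
  ... | true  | false = ⊥-elim (false≢true (trans (sym S⊆B)
          (extends-intro λ v → trans (sym (compatible-cong (h v))) (extends-elim S⊆A v))))
  ... | false | true  = ⊥-elim (false≢true (trans (sym S⊆A)
          (extends-intro λ v → trans (compatible-cong (h v)) (extends-elim S⊆B v))))

  extends-value : ∀ {A v b} → extends G S A ≡ true → S v ≡ just b → A v ≡ b
  extends-value {A} {v} {b} S⊆A Sv≡b = sound (subst (λ s → compatible s (A v) ≡ true) Sv≡b (extends-elim S⊆A v))
    where
    sound : ∀ {a} → compatible (just b) a ≡ true → a ≡ b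
    sound {a} eq with b Bool.≟ a
    ... | yes b≡a = sym b≡a

module RespectedEdge {n m : ℕ} (G : TreeFamily n m) (BT : IsBTGraph G) (S : Literals G)
                     {i j : Fin m} {ℓ : Fin n} (pe : isPE G i j ℓ ≡ true)
                     (resp : respects G S (i , j , ℓ) ≡ true) where
  open TreeFamily G
  open IsBTGraph BT
  open RootedTrees G BT
  open AssignmentFacts G
  open Extensions G S

  C : Fin n → Bool
  C = fullClause G (i , j , ℓ)

  i≢j : i ≢ j
  i≢j = proj₁ (isPE-parts i j ℓ pe)

  leafᵢ : isLeaf G i ℓ ≡ true
  leafᵢ = proj₁ (proj₂ (isPE-parts i j ℓ pe))

  leafⱼ : isLeaf G j ℓ ≡ true
  leafⱼ = proj₂ (proj₂ (isPE-parts i j ℓ pe))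

  nonRoot-negative : ∀ {v} → C v ≡ true → isRootVar G v ≡ false → S v ≡ just false
  nonRoot-negative {v} Cv notRoot = isNeg-sound
    (⇒ᵇ-elim (proj₁ (∧-true _ (allFin-elim _ resp v))) (cong₂ (λ a b → a ∧ not b) Cv notRoot))

  sibling-positive : ∀ {v u} → C v ≡ true → isInternal G v ≡ true → isSibling G v u ≡ true → S u ≡ just true
  sibling-positive {v} {u} Cv internal sibling = isPos-sound (⇒ᵇ-elim (allFin-elim _
    (⇒ᵇ-elim (proj₂ (∧-true _ (allFin-elim _ resp v))) (cong₂ _∧_ Cv internal)) u) sibling)

  Side : Fin m → Set
  Side t = t ≡ i ⊎ t ≡ j

  side-leaf : ∀ {t} → Side t → isLeaf G t ℓ ≡ true
  side-leaf (inj₁ refl) = leafᵢ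
  side-leaf (inj₂ refl) = leafⱼ

  side-path⊆C : ∀ {t v} → Side t → onPathToRoot G t ℓ v ≡ true → C v ≡ true
  side-path⊆C (inj₁ refl) on rewrite on = refl
  side-path⊆C (inj₂ refl) on rewrite on = Bool.∨-zeroʳ _

  otherLeaf-positive : ∀ {t ℓ′} → Side t → isLeaf G t ℓ′ ≡ true → ℓ′ ≢ ℓ →
    ∃ λ u → onPathToRoot G t ℓ′ u ≡ true × S u ≡ just true × u ≢ ℓ′
  otherLeaf-positive side leaf′ ℓ′≢ℓ with otherLeaf-meetsSibling (side-leaf side) leaf′ (ℓ′≢ℓ ∘ sym)
  ... | c , u , c-on , internal , sibling , u-on , u≢ℓ′ =
    u , u-on , sibling-positive (side-path⊆C side c-on) internal sibling , u≢ℓ′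

  ℓ-negative : S ℓ ≡ just false
  ℓ-negative = nonRoot-negative (side-path⊆C (inj₁ refl) (onPath-self (isLeaf-inT leafᵢ))) (isLeaf-notRootVar leafᵢ)

  true-isEndRoot : ∀ {A v} → extends G S A ≡ true → C v ≡ true → A v ≡ true → v ≡ root i ⊎ v ≡ root j
  true-isEndRoot {A} {v} S⊆A Cv Av with isRootVar G v in rootVar | ∨-true Cv
  ... | true  | inj₁ on = inj₁ (rootVar-inT rootVar (proj₁ (onPath-elim on)))
  ... | true  | inj₂ on = inj₂ (rootVar-inT rootVar (proj₁ (onPath-elim on)))
  ... | false | _ = ⊥-elim (false≢true (trans (sym (extends-value S⊆A (nonRoot-negative Cv rootVar))) Av))

  sidePath-true⇒root : ∀ {t A v} → Side t → extends G S A ≡ true → onPathToRoot G t ℓ v ≡ true →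
                       A v ≡ true → v ≡ root t
  sidePath-true⇒root side S⊆A on Av with true-isEndRoot S⊆A (side-path⊆C side on) Av
  ... | inj₁ refl = cong root (sym (root-unique (proj₁ (onPath-elim on))))
  ... | inj₂ refl = cong root (sym (root-unique (proj₁ (onPath-elim on))))

  rootsFalse-unsat : ∀ {A} → extends G S A ≡ true → A (root i) ≡ false → A (root j) ≡ false → satH G A ≡ false
  rootsFalse-unsat {A} S⊆A Aᵢ Aⱼ with satH G A in sat
  ... | false = refl
  ... | true with anyFin-witness _ (⇒ᵇ-elim (allFin-elim _ (allFin-elim _ (allFin-elim _ sat i) j) ℓ) pe)
  ...   | v , p with ∧-true (C v) p
  ...     | Cv , Av with true-isEndRoot S⊆A Cv Av
  ...       | inj₁ refl = ⊥-elim (false≢true (trans (sym Aᵢ) Av))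
  ...       | inj₂ refl = ⊥-elim (false≢true (trans (sym Aⱼ) Av))

  -- ℓ is a leaf of exactly the two trees Tᵢ and Tⱼ.
  sameLeaf-roots : ∀ {i′ j′} → isPE G i′ j′ ℓ ≡ true →
    fullClause G (i′ , j′ , ℓ) (root i) ≡ true × fullClause G (i′ , j′ , ℓ) (root j) ≡ true
  sameLeaf-roots {i′} {j′} pe′ with leafTwice i ℓ leafᵢ | isPE-parts i′ j′ ℓ pe′
  ... | k , _ , _ , twoTrees | i′≢j′ , leafᵢ′ , leafⱼ′ = inClause i iSide , inClause j jSide
    where
    inClause : ∀ t → t ≡ i′ ⊎ t ≡ j′ → fullClause G (i′ , j′ , ℓ) (root t) ≡ true
    inClause t (inj₁ refl) = cong (_∨ onPathToRoot G j′ ℓ (root t)) (onPath-root (isLeaf-inT leafᵢ′))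
    inClause t (inj₂ refl) = trans (cong (onPathToRoot G i′ ℓ (root t) ∨_) (onPath-root (isLeaf-inT leafⱼ′))) (Bool.∨-zeroʳ _)
    j≡k : j ≡ k
    j≡k with twoTrees j leafⱼ
    ... | inj₁ j≡i = ⊥-elim (i≢j (sym j≡i))
    ... | inj₂ j≡k = j≡k
    iSide : i ≡ i′ ⊎ i ≡ j′
    iSide with twoTrees i′ leafᵢ′ | twoTrees j′ leafⱼ′
    ... | inj₁ i′≡i | _         = inj₁ (sym i′≡i)
    ... | inj₂ _    | inj₁ j′≡i = inj₂ (sym j′≡i)
    ... | inj₂ i′≡k | inj₂ j′≡k = ⊥-elim (i′≢j′ (trans i′≡k (sym j′≡k)))
    jSide : j ≡ i′ ⊎ j ≡ j′
    jSide with twoTrees i′ leafᵢ′ | twoTrees j′ leafⱼ′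
    ... | inj₂ i′≡k | _         = inj₁ (trans j≡k (sym i′≡k))
    ... | inj₁ _    | inj₂ j′≡k = inj₂ (trans j≡k (sym j′≡k))
    ... | inj₁ i′≡i | inj₁ j′≡i = ⊥-elim (i′≢j′ (trans i′≡i (sym j′≡i)))

  rootTrue-sat : ∀ {i′ j′ B} → isPE G i′ j′ ℓ ≡ true → (B (root i) ∨ B (root j)) ≡ true →
                 satClause G B (fullClause G (i′ , j′ , ℓ)) ≡ true
  rootTrue-sat {B = B} pe′ rootTrue with sameLeaf-roots pe′ | ∨-true rootTrue
  ... | rootᵢ∈C′ , _ | inj₁ Bᵢ = satClause-intro B (root i) rootᵢ∈C′ Bᵢ
  ... | _ , rootⱼ∈C′ | inj₂ Bⱼ = satClause-intro B (root j) rootⱼ∈C′ Bⱼ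

  -- Every other clause through a free end root contains a vertex forced positive by S.
  module FreeEnd {t : Fin m} (side : Side t) (free : S (root t) ≡ nothing) where
    r : Fin n
    r = root t

    clauseThroughRoot : ∀ {i′ j′ ℓ′} → isPE G i′ j′ ℓ′ ≡ true → fullClause G (i′ , j′ , ℓ′) r ≡ true →
      isLeaf G t ℓ′ ≡ true × (∀ {u} → onPathToRoot G t ℓ′ u ≡ true → fullClause G (i′ , j′ , ℓ′) u ≡ true)
    clauseThroughRoot {i′} {j′} {ℓ′} pe′ r∈C′ with ∨-true r∈C′
    ... | inj₁ on with root-unique (proj₁ (onPath-elim on))
    ...   | refl = proj₁ (proj₂ (isPE-parts i′ j′ ℓ′ pe′)) , λ on′ → cong (_∨ onPathToRoot G j′ ℓ′ _) on′
    clauseThroughRoot {i′} {j′} {ℓ′} pe′ r∈C′ | inj₂ on with root-unique (proj₁ (onPath-elim on))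
    ...   | refl = proj₂ (proj₂ (isPE-parts i′ j′ ℓ′ pe′)) ,
                   λ on′ → trans (cong (onPathToRoot G i′ ℓ′ _ ∨_) on′) (Bool.∨-zeroʳ _)

    extends-flipAt : ∀ A → extends G S (flipAt r A) ≡ extends G S A
    extends-flipAt A = extends-cong same
      where
      same : ∀ v → S v ≡ nothing ⊎ flipAt r A v ≡ A v
      same v with v ≟ r
      ... | yes refl = inj₁ free
      ... | no v≢r   = inj₂ (updateAt-minimal v r A v≢r)

    satH-flipAt : ∀ {A} → extends G S A ≡ true → (A (root i) ∨ A (root j)) ≡ true →
      (flipAt r A (root i) ∨ flipAt r A (root j)) ≡ true → satH G (flipAt r A) ≡ satH G A
    satH-flipAt {A} S⊆A rootTrue rootTrue′ = allFin-cong λ i′ → allFin-cong λ j′ → allFin-cong λ ℓ′ → clause i′ j′ ℓ′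
      where
      S⊆A′ = trans (extends-flipAt A) S⊆A
      clause : ∀ i′ j′ ℓ′ → (isPE G i′ j′ ℓ′ ⇒ᵇ satClause G (flipAt r A) (fullClause G (i′ , j′ , ℓ′)))
                           ≡ (isPE G i′ j′ ℓ′ ⇒ᵇ satClause G A (fullClause G (i′ , j′ , ℓ′)))
      clause i′ j′ ℓ′ with isPE G i′ j′ ℓ′ in pe′
      ... | false = refl
      ... | true with fullClause G (i′ , j′ , ℓ′) r in r∈C′
      ...   | false = satClause-flipAt-outside A r∈C′
      ...   | true with clauseThroughRoot pe′ r∈C′ | ℓ′ ≟ ℓ
      ...     | _ , _ | yes refl = trans (rootTrue-sat pe′ rootTrue′) (sym (rootTrue-sat pe′ rootTrue))
      ...     | leaf′ , path⊆C′ | no ℓ′≢ℓ with otherLeaf-positive side leaf′ ℓ′≢ℓ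
      ...       | u , u-on , pos , _ = trans (satClause-intro (flipAt r A) u (path⊆C′ u-on) (extends-value S⊆A′ pos))
                                            (sym (satClause-intro A u (path⊆C′ u-on) (extends-value S⊆A pos)))

    r-notLeaf : ∀ k → isLeaf G k r ≡ false
    r-notLeaf k with isLeaf G k r in leaf
    ... | false = refl
    ... | true with root-unique (isLeaf-inT leaf)
    ...   | refl = ⊥-elim (isLeaf-nonRoot leaf refl)

    inFix-flipAt : ∀ {A} → extends G S A ≡ true → inFix G (flipAt r A) ≗ inFix G A
    inFix-flipAt {A} S⊆A v with v ≟ r
    ... | yes refl = trans (inFix-nonLeaf r-notLeaf) (sym (inFix-nonLeaf r-notLeaf))
    ... | no v≢r rewrite updateAt-minimal v r {not} A v≢r with A v in Av
    ...   | false = refl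
    ...   | true  = anyFin-cong λ i′ → anyFin-cong λ j′ → fixedBy i′ j′
      where
      S⊆A′ = trans (extends-flipAt A) S⊆A
      v≢ℓ : v ≢ ℓ
      v≢ℓ refl = false≢true (trans (sym (extends-value S⊆A ℓ-negative)) Av)
      othersFalse : (Fin n → Bool) → Fin m → Fin m → Fin n → Bool
      othersFalse B i′ j′ u = (fullClause G (i′ , j′ , v) u ∧ not (u == v)) ⇒ᵇ not (B u)
      fixedBy : ∀ i′ j′ → isPE G i′ j′ v ∧ allFin (othersFalse (flipAt r A) i′ j′)
                        ≡ isPE G i′ j′ v ∧ allFin (othersFalse A i′ j′)
      fixedBy i′ j′ with isPE G i′ j′ v in pe′
      ... | false = refl
      ... | true with fullClause G (i′ , j′ , v) r in r∈C′
      ...   | false = allFin-cong same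
        where
        same : ∀ u → othersFalse (flipAt r A) i′ j′ u ≡ othersFalse A i′ j′ u
        same u with u ≟ r
        ... | yes refl rewrite r∈C′ = refl
        ... | no u≢r rewrite updateAt-minimal u r {not} A u≢r = refl
      ...   | true with clauseThroughRoot pe′ r∈C′
      ...     | leaf′ , path⊆C′ with otherLeaf-positive side leaf′ v≢ℓ
      ...       | u , u-on , pos , u≢v = trans (allFin-false _ u (blocks (flipAt r A) S⊆A′))
                                              (sym (allFin-false _ u (blocks A S⊆A)))
        where
        blocks : ∀ B → extends G S B ≡ true → othersFalse B i′ j′ u ≡ false
        blocks B S⊆B rewrite path⊆C′ u-on | ==-false u≢v | extends-value S⊆B pos = refl

    countFix-flipAt : ∀ {A} → extends G S A ≡ true → countFix G (flipAt r A) ≡ countFix G A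
    countFix-flipAt S⊆A = countFix-cong (inFix-flipAt S⊆A)

module Matching {n m : ℕ} (G : TreeFamily n m) (BT : IsBTGraph G) (S : Literals G)
                (M : List (PEdge G)) (pm : IsPseudomatching G M)
                (ends-free : ∀ v → inUnionM G M v ≡ true → S v ≡ nothing) (φ : CNFof G M) where
  open TreeFamily G
  open RootedTrees G BT
  open AssignmentFacts G
  open Extensions G S

  Ix : Set
  Ix = Fin (length M)

  tailOf headOf : Ix → Fin m
  tailOf x = proj₁ (lookup M x)
  headOf x = proj₁ (proj₂ (lookup M x))

  leafOf : Ix → Fin n
  leafOf x = proj₂ (proj₂ (lookup M x))

  isRespected : Ix → Bool
  isRespected x = respects G S (lookup M x)

  module Respected {x : Ix} (resp : isRespected x ≡ true) = RespectedEdge G BT S (proj₁ pm x) resp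

  End : Ix → Fin m → Set
  End x t = t ≡ tailOf x ⊎ t ≡ headOf x

  End⇒ends : ∀ {x t} → End x t → ends G (lookup M x) t ≡ true
  End⇒ends {t = t} (inj₁ refl) rewrite ==-refl t = refl
  End⇒ends {t = t} (inj₂ refl) rewrite ==-refl t = Bool.∨-zeroʳ _

  endRoot-free : ∀ {x t} → End x t → S (root t) ≡ nothing
  endRoot-free {x} {t} end = ends-free (root t) (anyFin-intro _ x
    (anyFin-intro (λ k → ends G (lookup M x) k ∧ (root k == root t)) t (cong₂ _∧_ (End⇒ends end) (==-refl (root t)))))

  endRoots-distinct : ∀ {x y t s} → x ≢ y → End x t → End y s → root t ≢ root s
  endRoots-distinct {x} {y} {t} x≢y endₓ endᵧ rt≡rs with root-injective rt≡rs
  ... | refl = false≢true (trans (sym (proj₂ pm x y x≢y t (End⇒ends endₓ))) (End⇒ends endᵧ))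

  -- The clause of φ at x lies in the tree of chosenEnd x, so (given S) it can only be
  -- satisfied by the root of that tree.
  chosenEnd otherEnd : Ix → Fin m
  chosenEnd x = if φ x then tailOf x else headOf x
  otherEnd  x = if φ x then headOf x else tailOf x

  chosenRoot : Ix → Fin n
  chosenRoot x = root (chosenEnd x)

  chosenEnd-isEnd : ∀ x → End x (chosenEnd x)
  chosenEnd-isEnd x with φ x
  ... | true  = inj₁ refl
  ... | false = inj₂ refl

  otherEnd-isEnd : ∀ x → End x (otherEnd x)
  otherEnd-isEnd x with φ x
  ... | true  = inj₂ refl
  ... | false = inj₁ refl

  allChosenTrue : List Ix → Assignment n → Bool
  allChosenTrue []       A = true
  allChosenTrue (x ∷ xs) A = A (chosenRoot x) ∧ allChosenTrue xs A

  allChosenTrue-cong : ∀ xs {A B} → A ≗ B → allChosenTrue xs A ≡ allChosenTrue xs B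
  allChosenTrue-cong []       A≗B = refl
  allChosenTrue-cong (x ∷ xs) A≗B = cong₂ _∧_ (A≗B (chosenRoot x)) (allChosenTrue-cong xs A≗B)

  allChosenTrue-flipAt : ∀ {x t} xs → All (x ≢_) xs → End x t → ∀ A →
                         allChosenTrue xs (flipAt (root t) A) ≡ allChosenTrue xs A
  allChosenTrue-flipAt []       []            end A = refl
  allChosenTrue-flipAt (y ∷ xs) (x≢y ∷ x∉xs) end A = cong₂ _∧_
    (updateAt-minimal (chosenRoot y) _ A (endRoots-distinct x≢y end (chosenEnd-isEnd y) ∘ sym))
    (allChosenTrue-flipAt xs x∉xs end A)

  constrainedWeight : List Ix → Assignment n → ℚ
  constrainedWeight xs A = if satH G A ∧ (extends G S A ∧ allChosenTrue xs A) then weight G A else 0ℚ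

  constrainedWeight-cong : ∀ xs → Congruent (constrainedWeight xs)
  constrainedWeight-cong xs A B A≗B
    rewrite satH-cong A≗B | extends-cong (λ v → inj₂ (A≗B v)) | allChosenTrue-cong xs A≗B | weight-cong A≗B = refl

  constrainedWeight-∷ : ∀ x xs A → constrainedWeight (x ∷ xs) A ≡ (if A (chosenRoot x) then constrainedWeight xs A else 0ℚ)
  constrainedWeight-∷ x xs A with A (chosenRoot x)
  ... | true  = refl
  ... | false with satH G A | extends G S A
  ...   | true  | true  = refl
  ...   | true  | false = refl
  ...   | false | _     = refl

  clauseOf-chosen : ∀ x v → clauseOf G M φ x v ≡ onPathToRoot G (chosenEnd x) (leafOf x) v
  clauseOf-chosen x v with φ x
  ... | true  = refl
  ... | false = refl

  clauseOf-sat⇒chosenRoot : ∀ {x A} → isRespected x ≡ true → extends G S A ≡ true →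
                            satClause G A (clauseOf G M φ x) ≡ true → A (chosenRoot x) ≡ true
  clauseOf-sat⇒chosenRoot {x} {A} resp S⊆A sat with anyFin-witness _ sat
  ... | v , p with ∧-true (clauseOf G M φ x v) p
  ...   | on , Av rewrite clauseOf-chosen x v
          = subst (λ z → A z ≡ true) (Respected.sidePath-true⇒root resp (chosenEnd-isEnd x) S⊆A on Av) Av

  satCNF⇒allChosenTrue : ∀ {A} xs → All (λ x → isRespected x ≡ true) xs → extends G S A ≡ true →
                         satCNF G M φ A ≡ true → allChosenTrue xs A ≡ true
  satCNF⇒allChosenTrue []       []             S⊆A sat = refl
  satCNF⇒allChosenTrue (x ∷ xs) (resp ∷ resps) S⊆A sat =
    cong₂ _∧_ (clauseOf-sat⇒chosenRoot resp S⊆A (allFin-elim _ sat x)) (satCNF⇒allChosenTrue xs resps S⊆A sat)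

  module InductionStep {x : Ix} (resp : isRespected x ≡ true) {xs : List Ix} (x∉xs : All (x ≢_) xs) where
    open Respected resp

    EndsTrue : Assignment n → Set
    EndsTrue A = (A (root (tailOf x)) ∨ A (root (headOf x))) ≡ true

    constrainedWeight-flipAt : ∀ {t} → End x t → ∀ A → EndsTrue A → EndsTrue (flipAt (root t) A) →
                               constrainedWeight xs (flipAt (root t) A) ≡ constrainedWeight xs A
    constrainedWeight-flipAt {t} end A endsTrue endsTrue′
      rewrite allChosenTrue-flipAt xs x∉xs end A | FreeEnd.extends-flipAt end (endRoot-free end) A
      with extends G S A in S⊆A
    ... | true  rewrite FreeEnd.satH-flipAt end (endRoot-free end) S⊆A endsTrue endsTrue′
                      | FreeEnd.countFix-flipAt end (endRoot-free end) S⊆A = refl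
    ... | false rewrite Bool.∧-zeroʳ (satH G (flipAt (root t) A)) | Bool.∧-zeroʳ (satH G A) = refl

    chosen other : Fin n
    chosen = chosenRoot x
    other  = root (otherEnd x)

    chosen≢other : chosen ≢ other
    chosen≢other with φ x
    ... | true  = i≢j ∘ root-injective
    ... | false = i≢j ∘ sym ∘ root-injective

    endsTrue-∨ : ∀ (A : Assignment n) → (A (root (tailOf x)) ∨ A (root (headOf x))) ≡ (A chosen ∨ A other)
    endsTrue-∨ A with φ x
    ... | true  = refl
    ... | false = Bool.∨-comm (A (root (tailOf x))) _

    endsTrue : ∀ A → A chosen ≡ true ⊎ A other ≡ true → EndsTrue A
    endsTrue A = trans (endsTrue-∨ A) ∘ ∨-intro

    sumAll-chosenTrue : sumAll n (λ A → if A chosen then constrainedWeight xs A else 0ℚ)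
                        ≡ twoThirds *ℚ sumAll n (constrainedWeight xs)
    sumAll-chosenTrue = sumAll-ifTrue≡⅔ (constrainedWeight xs) (constrainedWeight-cong xs) chosen≢other
      vanishes flipChosen flipOther
      where
      vanishes : ∀ A → A chosen ≡ false → A other ≡ false → constrainedWeight xs A ≡ 0ℚ
      vanishes A chosenFalse otherFalse with extends G S A in S⊆A
      ... | false rewrite Bool.∧-zeroʳ (satH G A) = refl
      ... | true with ∨-false _ (trans (endsTrue-∨ A) (cong₂ _∨_ chosenFalse otherFalse))
      ...   | tailFalse , headFalse rewrite rootsFalse-unsat S⊆A tailFalse headFalse = refl
      flipChosen : ∀ A → A other ≡ true → constrainedWeight xs (flipAt chosen A) ≡ constrainedWeight xs A
      flipChosen A otherTrue = constrainedWeight-flipAt (chosenEnd-isEnd x) A (endsTrue A (inj₂ otherTrue))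
        (endsTrue (flipAt chosen A) (inj₂ (trans (updateAt-minimal other chosen {not} A (chosen≢other ∘ sym)) otherTrue)))
      flipOther : ∀ A → A chosen ≡ true → constrainedWeight xs (flipAt other A) ≡ constrainedWeight xs A
      flipOther A chosenTrue = constrainedWeight-flipAt (otherEnd-isEnd x) A (endsTrue A (inj₁ chosenTrue))
        (endsTrue (flipAt other A) (inj₁ (trans (updateAt-minimal chosen other {not} A chosen≢other) chosenTrue)))

  sumAll-constrained : ∀ xs → Unique xs → All (λ x → isRespected x ≡ true) xs →
    sumAll n (constrainedWeight xs) ≡ powℚ twoThirds (length xs) *ℚ sumAll n (constrainedWeight [])
  sumAll-constrained []       []           []             = sym (ℚ.*-identityˡ _)
  sumAll-constrained (x ∷ xs) (x∉xs ∷ uniq) (resp ∷ resps) = begin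
    sumAll n (constrainedWeight (x ∷ xs))
      ≡⟨ sumAll-cong (constrainedWeight-∷ x xs) ⟩
    sumAll n (λ A → if A (chosenRoot x) then constrainedWeight xs A else 0ℚ)
      ≡⟨ InductionStep.sumAll-chosenTrue resp x∉xs ⟩
    twoThirds *ℚ sumAll n (constrainedWeight xs)
      ≡⟨ cong (twoThirds *ℚ_) (sumAll-constrained xs uniq resps) ⟩
    twoThirds *ℚ (powℚ twoThirds (length xs) *ℚ sumAll n (constrainedWeight []))
      ≡⟨ sym (ℚ.*-assoc twoThirds (powℚ twoThirds (length xs)) _) ⟩
    powℚ twoThirds (length (x ∷ xs)) *ℚ sumAll n (constrainedWeight []) ∎
    where open ≡-Reasoning

  respectedIxs : List Ix
  respectedIxs = filter (λ x → isRespected x Bool.≟ true) (List.allFin (length M))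

  length-respectedIxs : length respectedIxs ≡ countRespected G S M
  length-respectedIxs = trans (length-filter-map (respects G S) (lookup M) (List.allFin (length M)))
    (cong (λ es → length (filter (λ e → respects G S e Bool.≟ true) es)) (map-lookup-allFin M))

  prESEC-bound : prESEC G M φ S ≤ℚ powℚ twoThirds (countRespected G S M) *ℚ prEC G S
  prESEC-bound = begin
    prESEC G M φ S                                                       ≤⟨ sumAll-mono satCNF-constrained ⟩
    sumAll n (constrainedWeight respectedIxs)                            ≡⟨ sumAll-constrained respectedIxs unique respected ⟩
    powℚ twoThirds (length respectedIxs) *ℚ sumAll n (constrainedWeight []) ≡⟨ cong₂ _*ℚ_ (cong (powℚ twoThirds) length-respectedIxs) noConstraint ⟩
    powℚ twoThirds (countRespected G S M) *ℚ prEC G S                    ∎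
    where
    open ℚ.≤-Reasoning
    P? = λ x → isRespected x Bool.≟ true
    unique : Unique respectedIxs
    unique = Unique.filter⁺ P? (Unique.allFin⁺ (length M))
    respected : All (λ x → isRespected x ≡ true) respectedIxs
    respected = All.all-filter P? (List.allFin (length M))
    noConstraint : sumAll n (constrainedWeight []) ≡ prEC G S
    noConstraint = sumAll-cong λ A → cong (λ b → if satH G A ∧ b then weight G A else 0ℚ) (Bool.∧-identityʳ _)
    satCNF-constrained : ∀ A → (if satH G A ∧ (satCNF G M φ A ∧ extends G S A) then weight G A else 0ℚ)
                               ≤ℚ constrainedWeight respectedIxs A
    satCNF-constrained A with satH G A | satCNF G M φ A in sat | extends G S A in S⊆A
    ... | true  | true  | true rewrite satCNF⇒allChosenTrue respectedIxs respected S⊆A sat = ℚ.≤-refl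
    ... | true  | true  | false = weight-nonNeg _ A
    ... | true  | false | _     = weight-nonNeg _ A
    ... | false | _     | _     = weight-nonNeg _ A

theorem7 : ∀ {n m} (G : TreeFamily n m) → IsPseudoexpander G →
    (M : List (PEdge G)) → IsPseudomatching G M →
    (p q : ℕ) → 0 < q → p ≤ q →
    (S : Literals G) →
    (∀ v → (S v ≡ nothing → inUnionM G M v ≡ true) × (inUnionM G M v ≡ true → S v ≡ nothing)) →
    IsComfortable G p q S M →
    (φ : CNFof G M) →
    powℚ (prESEC G M φ S) q ≤ℚ powℚ twoThirds (p * length M) *ℚ powℚ (prEC G S) q
theorem7 G PE M pm p q _ _ S vars (_ , comfortable) φ =
  powℚ-bound (countRespected G S M) q (p * length M)
    (measure-nonNeg _) (measure-nonNeg _) 0≤⅔ ⅔≤1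
    (Matching.prESEC-bound G (IsPseudoexpander.isBT PE) S M pm (proj₂ ∘ vars) φ)
    (subst (p * length M ≤_) (ℕ.*-comm q _) comfortable)
  where
  open AssignmentFacts G using (measure-nonNeg)
  0≤⅔ : 0ℚ ≤ℚ twoThirds
  0≤⅔ = toWitness {a? = 0ℚ ℚ.≤? twoThirds} _
  ⅔≤1 : twoThirds ≤ℚ 1ℚ
  ⅔≤1 = toWitness {a? = twoThirds ℚ.≤? 1ℚ} _
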